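{- Let $X$ be a finite set and $\mathfrak p\subseteq 2^X$ satisfy: (a) if $A\in\mathfrak p$ and $B\subset A$ then $B\in\mathfrak p$; (b) for $A\subseteq X$ with $|A|\ge 2$, if $\{x,y\}\in\mathfrak p$ for all distinct $x,y\in A$ then $A\in\mathfrak p$; (c) $\{x\}\in\mathfrak p$ for every $x\in X$. Suppose $(X,\mathfrak p)$ is symmetric, i.e. there is a group $\Gamma$ acting transitively on $X$ such that $\delta(A)\in\mathfrak p$ for every $A\in\mathfrak p$ and every $\delta\in\Gamma$. Let $A\in\mathfrak p$. Then $$|A|+\frac{\alpha(X,\mathfrak p)}{|X|}\,|\bar N[A]|\le \alpha(X,\mathfrak p),$$ and equality holds if and only if $A=\emptyset$, or $|A|=\alpha(X,\mathfrak p)$, or $A$ is an imprimitive $\mathfrak p$-subset.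
   Context: $\alpha(X,\mathfrak p)=\max\{|B|:B\in\mathfrak p\}$. For $A\subseteq X$, $N[A]=A\cup\{b\in X:\{a,b\}\notin\mathfrak p\text{ for some }a\in A\}$ and $\bar N[A]=X\setminus N[A]$. A nonempty $A\in\mathfrak p$ is called an imprimitive $\mathfrak p$-subset if $|A|<\alpha(X,\mathfrak p)$ and $\frac{|A|}{|N[A]|}=\frac{\alpha(X,\mathfrak p)}{|X|}$. -}

module Defs where

open import Level using (Level; _⊔_)
open import Data.Nat as ℕ using (ℕ; zero; suc; _*_; _<_; _≥_)
open import Data.Bool using (Bool; true; false; not; _∧_; _∨_; if_then_else_)
open import Data.Fin using (Fin; _≟_)
open import Data.Fin.Subset using (Subset; ∣_∣; ⁅_⁆; _∪_; _∈_; _⊆_; ∁; Nonempty)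
open import Data.Vec using (Vec; []; _∷_; tabulate; lookup)
open import Data.List using (List; []; _∷_; map; _++_; foldr)
open import Data.Bool.ListAction using (any)
open import Data.Product using (Σ; _×_)
open import Relation.Nullary.Decidable using (⌊_⌋)
open import Relation.Binary.PropositionalEquality using (_≡_; _≢_)
open import Algebra.Bundles using (Group)

-- A family 𝔭 ⊆ 2^X of subsets of the finite set X = Fin n is given by its
-- (Boolean) indicator function: B ∈ 𝔭  iff  𝔭 B ≡ true.
Family : ℕ → Set
Family n = Subset n → Bool

allSubsets : (n : ℕ) → List (Subset n)
allSubsets zero    = [] ∷ []
allSubsets (suc n) = map (true ∷_) (allSubsets n) ++ map (false ∷_) (allSubsets n)

-- α(X,𝔭) = max { |B| : B ∈ 𝔭 }   (0 if 𝔭 is empty)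
α : ∀ {n} → Family n → ℕ
α {n} 𝔭 = foldr (λ B m → if 𝔭 B then ∣ B ∣ ℕ.⊔ m else m) 0 (allSubsets n)

-- the two-element (or one-element if x ≡ y) subset {x , y}
pair : ∀ {n} → Fin n → Fin n → Subset n
pair x y = ⁅ x ⁆ ∪ ⁅ y ⁆

allFin : (n : ℕ) → List (Fin n)
allFin n = Data.Vec.toList (tabulate (λ i → i))

N[_] : ∀ {n} → Family n → Subset n → Subset n
N[_] {n} 𝔭 A = tabulate λ b →
  lookup A b ∨ any (λ a → lookup A a ∧ not (𝔭 (pair a b))) (allFin n)

N̄[_] : ∀ {n} → Family n → Subset n → Subset n
N̄[ 𝔭 ] A = ∁ (N[ 𝔭 ] A)

image : ∀ {n} → (Fin n → Fin n) → Subset n → Subset n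
image {n} δ A = tabulate λ y → any (λ x → lookup A x ∧ ⌊ δ x ≟ y ⌋) (allFin n)

record IsIndependenceFamily {n : ℕ} (𝔭 : Family n) : Set where
  field
    downClosed : ∀ A B → 𝔭 A ≡ true → B ⊆ A → B ≢ A → 𝔭 B ≡ true
    pairClosed : ∀ A → ∣ A ∣ ≥ 2 →
                 (∀ x y → x ∈ A → y ∈ A → x ≢ y → 𝔭 (pair x y) ≡ true) →
                 𝔭 A ≡ true
    singletons : ∀ x → 𝔭 ⁅ x ⁆ ≡ true

record GroupAction {c ℓ : Level} (Γ : Group c ℓ) (n : ℕ) : Set (c ⊔ ℓ) where
  open Group Γ
  field
    act      : Carrier → Fin n → Fin n
    act-cong : ∀ {g h} → g ≈ h → ∀ x → act g x ≡ act h x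
    act-ε    : ∀ x → act ε x ≡ x
    act-∙    : ∀ g h x → act (g ∙ h) x ≡ act g (act h x)

record IsSymmetric (c ℓ : Level) {n : ℕ} (𝔭 : Family n) : Set (Level.suc (c ⊔ ℓ)) where
  field
    Γ          : Group c ℓ
    action     : GroupAction Γ n
  open GroupAction action public
  field
    transitive : ∀ x y → Σ (Group.Carrier Γ) (λ δ → act δ x ≡ y)
    preserves  : ∀ δ A → 𝔭 A ≡ true → 𝔭 (image (act δ) A) ≡ true

-- A nonempty A ∈ 𝔭 with |A| < α and |A| / |N[A]| = α / |X|
-- (the ratio equation written with cleared denominators; |X| = n).
Imprimitive : ∀ {n} → Family n → Subset n → Set
Imprimitive {n} 𝔭 A =
  Nonempty A × 𝔭 A ≡ true × ∣ A ∣ < α 𝔭 × ∣ A ∣ * n ≡ α 𝔭 * ∣ N[ 𝔭 ] A ∣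

module Submission where

-- Since |N[A]| + |N̄[A]| = |X|, the inequality is the ratio bound |A| · |X| ≤ α · |N[A]|.
-- Its proof is an averaging argument over the (finitely many) automorphisms σ of the
-- pair structure of 𝔭, i.e. injective self-maps of X sending 𝔭-pairs to 𝔭-pairs.
-- Fix I ∈ 𝔭 with |I| = α.  The points of I that σ sends outside N[A] have images
-- forming a clique outside N[A], which can be added to A (extension lemma); hence σ
-- sends at least |A| points of I into N[A].  Summing over all σ and counting the pairs
-- (σ, x) with x ∈ I, σ x ∈ N[A] the other way round, transitivity of Γ shows that each
-- y ∈ X is the image of x under a fraction 1/|X| of the automorphisms, so the total is
-- #Aut · |I| · |N[A]| / |X|, which gives the ratio bound.  The equality cases then
-- follow directly from the definitions, using the extension lemma once more.

open import Defs
open import Level using (Level)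
open import Algebra.Bundles using (Group)
open import Data.Nat using (ℕ; zero; suc; _+_; _*_; _⊔_; _≤_; _<_; z≤n; s≤s; z<s; >-nonZero)
open import Data.Nat.Properties hiding (_≟_; suc-injective)
open import Data.Nat.Solver using (module +-*-Solver)
open +-*-Solver using (solve; _:*_; _:=_)
open import Algebra.Properties.Semiring.Sum +-*-semiring
  using (sum; sum-cong-≗; sum-replicate-zero; ∑-distrib-+; ∑-comm; sum-permute;
         *-distribˡ-sum; *-distribʳ-sum)
open import Algebra.Properties.CommutativeSemigroup *-commutativeSemigroup
  using (x∙yz≈y∙xz; x∙yz≈z∙xy)
open import Data.Bool using (Bool; true; false; not; _∧_; _∨_; if_then_else_)
open import Data.Bool.Properties using (∧-conicalˡ; ∧-conicalʳ; ∨-zeroʳ; not-injective)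
  renaming (_≟_ to _≟ᴮ_)
open import Data.Bool.ListAction using (any)
open import Data.List using (List; foldr) renaming ([] to []ˡ; _∷_ to _∷ˡ_)
open import Data.List.Relation.Unary.Any using (here; there)
open import Data.List.Membership.Propositional using () renaming (_∈_ to _∈ˡ_)
open import Data.List.Membership.Propositional.Properties using (∈-++⁺ˡ; ∈-++⁺ʳ; ∈-map⁺)
open import Data.Fin using (Fin; zero; suc; _≟_)
open import Data.Fin.Properties using (suc-injective; all?)
open import Data.Fin.Permutation using (permutation)
open import Data.Fin.Subset using (Subset; ∣_∣; _∈_; _∉_; _⊆_; _∪_; _-_; ⁅_⁆; ⊥; ∁; Nonempty; Empty)
open import Data.Fin.Subset.Properties
  using (Empty-unique; nonempty?; x∈p⇒∣p-x∣<∣p∣; ∣⊥∣≡0; ∣p∣≤n; ∣∁p∣≡n∸∣p∣; ∣⁅x⁆∣≡1;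
         ∉⊥; x∈∁p⇒x∉p; x∈⁅x⁆; x∈⁅y⁆⇒x≡y; x∈p∪q⁺; x∈p∪q⁻; ∪-comm; ∪-idem; ⊆-antisym)
open import Data.Vec using (Vec; []; _∷_; lookup; tabulate; toList; map; here; there)
open import Data.Vec.Properties using ([]=⇒lookup; lookup⇒[]=; lookup∘tabulate; lookup-map; ≡-dec)
open import Data.Product using (∃; _×_; _,_)
open import Data.Sum using (_⊎_; inj₁; inj₂)
import Data.Sum as Sum
open import Function using (_∘_; id)
open import Function.Bundles using (_⇔_; mk⇔; module Equivalence)
open import Relation.Nullary using (Dec; yes; no; contradiction)
open import Relation.Nullary.Decidable using (⌊_⌋; does; _×-dec_; _→-dec_; does-⇔; dec-true)
open import Relation.Binary.PropositionalEquality

⟦_⟧ : Bool → ℕ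
⟦ true ⟧  = 1
⟦ false ⟧ = 0

⟦∧⟧ : ∀ a b → ⟦ a ∧ b ⟧ ≡ ⟦ a ⟧ * ⟦ b ⟧
⟦∧⟧ true  b = sym (+-identityʳ ⟦ b ⟧)
⟦∧⟧ false b = refl

indicator-*-mono : ∀ {P : Set} (P? : Dec P) {a b} → (P → a ≤ b) → ⟦ does P? ⟧ * a ≤ ⟦ does P? ⟧ * b
indicator-*-mono (yes p) a≤b = +-monoˡ-≤ 0 (a≤b p)
indicator-*-mono (no _)  a≤b = z≤n

sum-mono : ∀ {n} {f g : Fin n → ℕ} → (∀ i → f i ≤ g i) → sum f ≤ sum g
sum-mono {zero}  f≤g = z≤n
sum-mono {suc n} f≤g = +-mono-≤ (f≤g zero) (sum-mono (f≤g ∘ suc))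

term≤sum : ∀ {n} (f : Fin n → ℕ) i → f i ≤ sum f
term≤sum f zero    = m≤m+n _ _
term≤sum f (suc i) = ≤-trans (term≤sum (f ∘ suc) i) (m≤n+m _ _)

sum-const : ∀ n c → sum {n} (λ _ → c) ≡ n * c
sum-const zero    c = refl
sum-const (suc n) c = cong (c +_) (sum-const n c)

sum-*ˡ : ∀ {n} c (f : Fin n → ℕ) → sum (λ i → c * f i) ≡ c * sum f
sum-*ˡ c f = sym (*-distribˡ-sum c f)

_==_ : ∀ {n} → Fin n → Fin n → Bool
x == y = ⌊ x ≟ y ⌋

==-sound : ∀ {n} {x y : Fin n} → x == y ≡ true → x ≡ y
==-sound {x = x} {y} eq with x ≟ y
... | yes x≡y = x≡y

==-complete : ∀ {n} {x y : Fin n} → x ≡ y → x == y ≡ true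
==-complete {x = x} refl with x ≟ x
... | yes _  = refl
... | no x≢x = contradiction refl x≢x

==-suc : ∀ {n} (x y : Fin n) → suc x == suc y ≡ x == y
==-suc x y with x ≟ y
... | yes refl = refl
... | no _     = refl

==-injective : ∀ {n} (τ : Fin n → Fin n) → (∀ {a b} → τ a ≡ τ b → a ≡ b) →
               ∀ a b → τ a == τ b ≡ a == b
==-injective τ inj a b with τ a ≟ τ b | a ≟ b
... | yes _       | yes _   = refl
... | yes τa≡τb   | no a≢b  = contradiction (inj τa≡τb) a≢b
... | no τa≢τb    | yes a≡b = contradiction (cong τ a≡b) τa≢τb
... | no _        | no _    = refl

sum-δ : ∀ {n} (x : Fin n) (g : Fin n → ℕ) → sum (λ y → ⟦ x == y ⟧ * g y) ≡ g x
sum-δ {suc n} zero g = begin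
  g zero + 0 + sum {n} (λ _ → 0) ≡⟨ cong (g zero + 0 +_) (sum-replicate-zero n) ⟩
  g zero + 0 + 0                 ≡⟨ +-identityʳ _ ⟩
  g zero + 0                     ≡⟨ +-identityʳ _ ⟩
  g zero                         ∎
  where open ≡-Reasoning
sum-δ {suc n} (suc x) g =
  trans (sum-cong-≗ (λ y → cong (λ b → ⟦ b ⟧ * g (suc y)) (==-suc x y))) (sum-δ x (g ∘ suc))

sum-δ₁ : ∀ {n} (x : Fin n) → sum (λ y → ⟦ x == y ⟧) ≡ 1
sum-δ₁ x = trans (sum-cong-≗ (λ y → sym (*-identityʳ ⟦ x == y ⟧))) (sum-δ x (λ _ → 1))

-- Disjunction over all of Fin n.  Defs phrases N[A] and image with
-- `any _ (allFin n)`, which unfolds to this recursion.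
anyᶠ : ∀ n → (Fin n → Bool) → Bool
anyᶠ zero    g = false
anyᶠ (suc n) g = g zero ∨ anyᶠ n (g ∘ suc)

any-tabulate : ∀ {A : Set} n (g : A → Bool) (f : Fin n → A) →
               any g (toList (tabulate f)) ≡ anyᶠ n (g ∘ f)
any-tabulate zero    g f = refl
any-tabulate (suc n) g f = cong (g (f zero) ∨_) (any-tabulate n g (f ∘ suc))

anyᶠ-witness : ∀ n (g : Fin n → Bool) → anyᶠ n g ≡ true → ∃ λ i → g i ≡ true
anyᶠ-witness (suc n) g eq with g zero in g0
... | true  = zero , g0
... | false with anyᶠ-witness n (g ∘ suc) eq
...   | i , gi = suc i , gi

anyᶠ-intro : ∀ n (g : Fin n → Bool) i → g i ≡ true → anyᶠ n g ≡ true
anyᶠ-intro (suc n) g zero    gi rewrite gi = refl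
anyᶠ-intro (suc n) g (suc i) gi with g zero
... | true  = refl
... | false = anyᶠ-intro n (g ∘ suc) i gi

anyᶠ-count : ∀ n (g : Fin n → Bool) → (∀ {i j} → g i ≡ true → g j ≡ true → i ≡ j) →
             ⟦ anyᶠ n g ⟧ ≡ sum (λ i → ⟦ g i ⟧)
anyᶠ-count zero    g unique = refl
anyᶠ-count (suc n) g unique with g zero in g0
... | true  = cong suc (sym (trans (sum-cong-≗ no-other) (sum-replicate-zero n)))
  where
  no-other : ∀ i → ⟦ g (suc i) ⟧ ≡ 0
  no-other i with g (suc i) in gi
  ... | false = refl
  ... | true  with unique g0 gi
  ...   | ()
... | false = anyᶠ-count n (g ∘ suc) (λ gi gj → suc-injective (unique gi gj))

∈⇒lookup : ∀ {n} {x : Fin n} {B : Subset n} → x ∈ B → lookup B x ≡ true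
∈⇒lookup = []=⇒lookup

lookup⇒∈ : ∀ {n} {x : Fin n} {B : Subset n} → lookup B x ≡ true → x ∈ B
lookup⇒∈ {x = x} {B} = lookup⇒[]= x B

lookup⇒∉ : ∀ {n} {x : Fin n} {B : Subset n} → lookup B x ≡ false → x ∉ B
lookup⇒∉ Bx x∈B with trans (sym (∈⇒lookup x∈B)) Bx
... | ()

∈-tabulate : ∀ {n} {f : Fin n → Bool} {x} → x ∈ tabulate f → f x ≡ true
∈-tabulate {f = f} {x} x∈ = trans (sym (lookup∘tabulate f x)) (∈⇒lookup x∈)

∈-tabulate⁺ : ∀ {n} {f : Fin n → Bool} {x} → f x ≡ true → x ∈ tabulate f
∈-tabulate⁺ {f = f} {x} fx = lookup⇒∈ (trans (lookup∘tabulate f x) fx)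

size≡sum : ∀ {n} (B : Subset n) → ∣ B ∣ ≡ sum (λ x → ⟦ lookup B x ⟧)
size≡sum []          = refl
size≡sum (true ∷ B)  = cong suc (size≡sum B)
size≡sum (false ∷ B) = size≡sum B

size-∪ : ∀ {n} (B C : Subset n) → (∀ {x} → x ∈ B → x ∉ C) → ∣ B ∪ C ∣ ≡ ∣ B ∣ + ∣ C ∣
size-∪ []          []          disj = refl
size-∪ (true ∷ B)  (true ∷ C)  disj = contradiction here (disj here)
size-∪ (true ∷ B)  (false ∷ C) disj = cong suc (size-∪ B C (λ x∈B x∈C → disj (there x∈B) (there x∈C)))
size-∪ (false ∷ B) (true ∷ C)  disj = trans (cong suc (size-∪ B C (λ x∈B x∈C → disj (there x∈B) (there x∈C))))
                                            (sym (+-suc ∣ B ∣ ∣ C ∣))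
size-∪ (false ∷ B) (false ∷ C) disj = size-∪ B C (λ x∈B x∈C → disj (there x∈B) (there x∈C))

size-product : ∀ {n} (I B : Subset n) →
               sum (λ x → sum (λ y → ⟦ lookup I x ⟧ * ⟦ lookup B y ⟧)) ≡ ∣ I ∣ * ∣ B ∣
size-product I B = begin
  sum (λ x → sum (λ y → ⟦ lookup I x ⟧ * ⟦ lookup B y ⟧))  ≡⟨ sum-cong-≗ (λ x → sum-*ˡ ⟦ lookup I x ⟧ (λ y → ⟦ lookup B y ⟧)) ⟩
  sum (λ x → ⟦ lookup I x ⟧ * sum (λ y → ⟦ lookup B y ⟧))  ≡⟨ *-distribʳ-sum _ (λ x → ⟦ lookup I x ⟧) ⟨
  sum (λ x → ⟦ lookup I x ⟧) * sum (λ y → ⟦ lookup B y ⟧)  ≡⟨ cong₂ _*_ (size≡sum I) (size≡sum B) ⟨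
  ∣ I ∣ * ∣ B ∣                                            ∎
  where open ≡-Reasoning

size≡0⇒≡⊥ : ∀ {n} {B : Subset n} → ∣ B ∣ ≡ 0 → B ≡ ⊥
size≡0⇒≡⊥ {B = B} size≡0 = Empty-unique λ (x , x∈B) →
  contradiction (subst (∣ B - x ∣ <_) size≡0 (x∈p⇒∣p-x∣<∣p∣ x∈B)) λ ()

size>0⇒nonempty : ∀ {n} {B : Subset n} → 0 < ∣ B ∣ → Nonempty B
size>0⇒nonempty {n} {B} size>0 with nonempty? B
... | yes nonempty = nonempty
... | no  empty    = contradiction (trans (cong ∣_∣ (Empty-unique empty)) (∣⊥∣≡0 n)) (>⇒≢ size>0)

size-∁ : ∀ {n} (B : Subset n) → ∣ ∁ B ∣ + ∣ B ∣ ≡ n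
size-∁ B = trans (cong (_+ ∣ B ∣) (∣∁p∣≡n∸∣p∣ B)) (m∸n+n≡m (∣p∣≤n B))

∈-pair⁻ : ∀ {n} (a b : Fin n) {x} → x ∈ pair a b → x ≡ a ⊎ x ≡ b
∈-pair⁻ a b x∈ = Sum.map (x∈⁅y⁆⇒x≡y a) (x∈⁅y⁆⇒x≡y b) (x∈p∪q⁻ ⁅ a ⁆ ⁅ b ⁆ x∈)

∈-pairˡ : ∀ {n} (a b : Fin n) → a ∈ pair a b
∈-pairˡ a b = x∈p∪q⁺ (inj₁ (x∈⁅x⁆ a))

∈-pairʳ : ∀ {n} (a b : Fin n) → b ∈ pair a b
∈-pairʳ a b = x∈p∪q⁺ (inj₂ (x∈⁅x⁆ b))

∈-image⁻ : ∀ {n} {τ : Fin n → Fin n} {S y} → y ∈ image τ S → ∃ λ x → x ∈ S × τ x ≡ y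
∈-image⁻ {n} {τ} {S} {y} y∈ with anyᶠ-witness n _ (trans (sym (any-tabulate n _ id)) (∈-tabulate y∈))
... | x , hit = x , lookup⇒∈ (∧-conicalˡ _ _ hit) , ==-sound (∧-conicalʳ _ _ hit)

∈-image⁺ : ∀ {n} (τ : Fin n → Fin n) {S x} → x ∈ S → τ x ∈ image τ S
∈-image⁺ {n} τ {S} {x} x∈S = ∈-tabulate⁺ (trans (any-tabulate n _ id)
  (anyᶠ-intro n _ x (subst₂ (λ s t → s ∧ t ≡ true) (sym (∈⇒lookup x∈S)) (sym (==-complete refl)) refl)))

image-pair : ∀ {n} (τ : Fin n → Fin n) (a b : Fin n) → image τ (pair a b) ≡ pair (τ a) (τ b)
image-pair τ a b = ⊆-antisym image⊆pair pair⊆image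
  where
  image⊆pair : ∀ {y} → y ∈ image τ (pair a b) → y ∈ pair (τ a) (τ b)
  image⊆pair y∈ with ∈-image⁻ {τ = τ} y∈
  ... | x , x∈ , refl with ∈-pair⁻ a b x∈
  ...   | inj₁ refl = ∈-pairˡ (τ a) (τ b)
  ...   | inj₂ refl = ∈-pairʳ (τ a) (τ b)
  pair⊆image : ∀ {y} → y ∈ pair (τ a) (τ b) → y ∈ image τ (pair a b)
  pair⊆image y∈ with ∈-pair⁻ (τ a) (τ b) y∈
  ... | inj₁ refl = ∈-image⁺ τ (∈-pairˡ a b)
  ... | inj₂ refl = ∈-image⁺ τ (∈-pairʳ a b)

size-image : ∀ {n} (τ : Fin n → Fin n) → (∀ {a b} → τ a ≡ τ b → a ≡ b) →
             ∀ S → ∣ image τ S ∣ ≡ ∣ S ∣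
size-image {n} τ inj S = begin
  ∣ image τ S ∣                                          ≡⟨ size≡sum (image τ S) ⟩
  sum (λ y → ⟦ lookup (image τ S) y ⟧)                   ≡⟨ sum-cong-≗ (λ y → cong ⟦_⟧ (lookup-image y)) ⟩
  sum (λ y → ⟦ anyᶠ n (λ x → lookup S x ∧ τ x == y) ⟧)   ≡⟨ sum-cong-≗ (λ y → anyᶠ-count n _ (unique y)) ⟩
  sum (λ y → sum (λ x → ⟦ lookup S x ∧ τ x == y ⟧))      ≡⟨ ∑-comm (λ y x → ⟦ lookup S x ∧ τ x == y ⟧) ⟩
  sum (λ x → sum (λ y → ⟦ lookup S x ∧ τ x == y ⟧))      ≡⟨ sum-cong-≗ (λ x → sum-cong-≗ {n} (λ y → ⟦∧⟧ (lookup S x) _)) ⟩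
  sum (λ x → sum (λ y → ⟦ lookup S x ⟧ * ⟦ τ x == y ⟧))  ≡⟨ sum-cong-≗ (λ x → sum-*ˡ {n} ⟦ lookup S x ⟧ _) ⟩
  sum (λ x → ⟦ lookup S x ⟧ * sum (λ y → ⟦ τ x == y ⟧))  ≡⟨ sum-cong-≗ {n} (λ x → cong (⟦ lookup S x ⟧ *_) (sum-δ₁ (τ x))) ⟩
  sum (λ x → ⟦ lookup S x ⟧ * 1)                         ≡⟨ sum-cong-≗ (λ x → *-identityʳ ⟦ lookup S x ⟧) ⟩
  sum (λ x → ⟦ lookup S x ⟧)                             ≡⟨ size≡sum S ⟨
  ∣ S ∣                                                  ∎
  where
  open ≡-Reasoning
  lookup-image : ∀ y → lookup (image τ S) y ≡ anyᶠ n (λ x → lookup S x ∧ τ x == y)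
  lookup-image y = trans (lookup∘tabulate _ y) (any-tabulate n _ id)
  unique : ∀ y {i j} → lookup S i ∧ τ i == y ≡ true → lookup S j ∧ τ j == y ≡ true → i ≡ j
  unique y hitᵢ hitⱼ = inj (trans (==-sound (∧-conicalʳ _ _ hitᵢ)) (sym (==-sound (∧-conicalʳ _ _ hitⱼ))))

lookup-N : ∀ {n} (𝔭 : Family n) A b →
           lookup (N[ 𝔭 ] A) b ≡ lookup A b ∨ anyᶠ n (λ a → lookup A a ∧ not (𝔭 (pair a b)))
lookup-N {n} 𝔭 A b = trans (lookup∘tabulate _ b) (cong (lookup A b ∨_) (any-tabulate n _ id))

∈-N⁺ : ∀ {n} (𝔭 : Family n) {A b} →
       b ∈ A ⊎ (∃ λ a → a ∈ A × 𝔭 (pair a b) ≡ false) → b ∈ N[ 𝔭 ] A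
∈-N⁺ 𝔭 {A} {b} (inj₁ b∈A) =
  lookup⇒∈ (trans (lookup-N 𝔭 A b) (cong (_∨ anyᶠ _ (λ a → lookup A a ∧ not (𝔭 (pair a b)))) (∈⇒lookup b∈A)))
∈-N⁺ {n} 𝔭 {A} {b} (inj₂ (a , a∈A , apart)) =
  lookup⇒∈ (trans (lookup-N 𝔭 A b) (trans (cong (lookup A b ∨_) (anyᶠ-intro n _ a witness)) (∨-zeroʳ _)))
  where
  witness : lookup A a ∧ not (𝔭 (pair a b)) ≡ true
  witness rewrite ∈⇒lookup a∈A | apart = refl

∈-N⁻ : ∀ {n} (𝔭 : Family n) {A b} →
       b ∈ N[ 𝔭 ] A → b ∈ A ⊎ (∃ λ a → a ∈ A × 𝔭 (pair a b) ≡ false)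
∈-N⁻ {n} 𝔭 {A} {b} b∈N with lookup A b in Ab | trans (sym (lookup-N 𝔭 A b)) (∈⇒lookup b∈N)
... | true  | _         = inj₁ (lookup⇒∈ Ab)
... | false | some-apart with anyᶠ-witness n _ some-apart
...   | a , hit = inj₂ (a , lookup⇒∈ (∧-conicalˡ _ _ hit) , not-injective (∧-conicalʳ _ _ hit))

∉N⇒∉ : ∀ {n} (𝔭 : Family n) {A b} → b ∉ N[ 𝔭 ] A → b ∉ A
∉N⇒∉ 𝔭 b∉N b∈A = b∉N (∈-N⁺ 𝔭 (inj₁ b∈A))

∉N⇒paired : ∀ {n} (𝔭 : Family n) {A a b} → b ∉ N[ 𝔭 ] A → a ∈ A → 𝔭 (pair a b) ≡ true
∉N⇒paired 𝔭 {a = a} {b} b∉N a∈A with 𝔭 (pair a b) in ab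
... | true  = refl
... | false = contradiction (∈-N⁺ 𝔭 (inj₂ (a , a∈A , ab))) b∉N

N[⊥]≡⊥ : ∀ {n} (𝔭 : Family n) → N[ 𝔭 ] ⊥ ≡ ⊥
N[⊥]≡⊥ 𝔭 = Empty-unique λ (b , b∈N) → Sum.[ ∉⊥ , (λ (a , a∈⊥ , _) → ∉⊥ a∈⊥) ] (∈-N⁻ 𝔭 b∈N)

∈-allSubsets : ∀ n (B : Subset n) → B ∈ˡ allSubsets n
∈-allSubsets zero    []          = here refl
∈-allSubsets (suc n) (true ∷ B)  = ∈-++⁺ˡ (∈-map⁺ (true ∷_) (∈-allSubsets n B))
∈-allSubsets (suc n) (false ∷ B) = ∈-++⁺ʳ _ (∈-map⁺ (false ∷_) (∈-allSubsets n B))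

module _ {n} (𝔭 : Family n) where

  private
    maxSize : List (Subset n) → ℕ
    maxSize = foldr (λ B m → if 𝔭 B then ∣ B ∣ ⊔ m else m) 0

    maxSize-bound : ∀ L {B} → B ∈ˡ L → 𝔭 B ≡ true → ∣ B ∣ ≤ maxSize L
    maxSize-bound (B ∷ˡ L) (here refl) B∈𝔭 rewrite B∈𝔭 = m≤m⊔n ∣ B ∣ (maxSize L)
    maxSize-bound (C ∷ˡ L) (there B∈L) B∈𝔭 with 𝔭 C
    ... | true  = ≤-trans (maxSize-bound L B∈L B∈𝔭) (m≤n⊔m ∣ C ∣ (maxSize L))
    ... | false = maxSize-bound L B∈L B∈𝔭

    maxSize-attained : ∀ L → maxSize L ≡ 0 ⊎ ∃ λ I → 𝔭 I ≡ true × ∣ I ∣ ≡ maxSize L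
    maxSize-attained []ˡ     = inj₁ refl
    maxSize-attained (C ∷ˡ L) with 𝔭 C in C∈𝔭
    ... | false = maxSize-attained L
    ... | true with ⊔-sel ∣ C ∣ (maxSize L)
    ...   | inj₁ max≡C = inj₂ (C , C∈𝔭 , sym max≡C)
    ...   | inj₂ max≡L rewrite max≡L = maxSize-attained L

  α-bound : ∀ {B} → 𝔭 B ≡ true → ∣ B ∣ ≤ α 𝔭
  α-bound {B} = maxSize-bound (allSubsets n) (∈-allSubsets n B)

  α-attained : α 𝔭 ≡ 0 ⊎ ∃ λ I → 𝔭 I ≡ true × ∣ I ∣ ≡ α 𝔭
  α-attained = maxSize-attained (allSubsets n)

Clique : ∀ {n} → Family n → Subset n → Set
Clique 𝔭 C = ∀ {x y} → x ∈ C → y ∈ C → 𝔭 (pair x y) ≡ true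

module IndependenceFamily {n} {𝔭 : Family n} (ind : IsIndependenceFamily 𝔭) where
  open IsIndependenceFamily ind

  ⊆-closed : ∀ {A B} → 𝔭 A ≡ true → B ⊆ A → 𝔭 B ≡ true
  ⊆-closed {A} {B} A∈𝔭 B⊆A with ≡-dec _≟ᴮ_ B A
  ... | yes refl = A∈𝔭
  ... | no  B≢A  = downClosed A B A∈𝔭 B⊆A B≢A

  member⇒clique : ∀ {A} → 𝔭 A ≡ true → Clique 𝔭 A
  member⇒clique {A} A∈𝔭 {a} {b} a∈A b∈A = ⊆-closed A∈𝔭 pair⊆A
    where
    pair⊆A : pair a b ⊆ A
    pair⊆A x∈ with ∈-pair⁻ a b x∈
    ... | inj₁ refl = a∈A
    ... | inj₂ refl = b∈A

  -- Conversely, by axioms (b) and (c), a clique is at most as large as α.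
  clique-size : ∀ {C} → Clique 𝔭 C → ∣ C ∣ ≤ α 𝔭
  clique-size {C} clique with ∣ C ∣ in size
  ... | zero        = z≤n
  ... | suc (suc k) = subst (_≤ α 𝔭) size
        (α-bound 𝔭 (pairClosed C (subst (2 ≤_) (sym size) (s≤s (s≤s z≤n))) (λ x y x∈ y∈ _ → clique x∈ y∈)))
  ... | suc zero with size>0⇒nonempty {B = C} (subst (0 <_) (sym size) (s≤s z≤n))
  ...   | x , _ = subst (_≤ α 𝔭) (∣⁅x⁆∣≡1 x) (α-bound 𝔭 (singletons x))

  -- Extension lemma: a clique T outside N[A] can be added to A ∈ 𝔭, so |A| + |T| ≤ α.
  extension : ∀ {A T} → 𝔭 A ≡ true → (∀ {t} → t ∈ T → t ∉ N[ 𝔭 ] A) → Clique 𝔭 T →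
              ∣ A ∣ + ∣ T ∣ ≤ α 𝔭
  extension {A} {T} A∈𝔭 outside T-clique =
    subst (_≤ α 𝔭) (size-∪ A T disjoint) (clique-size union-clique)
    where
    disjoint : ∀ {x} → x ∈ A → x ∉ T
    disjoint x∈A x∈T = ∉N⇒∉ 𝔭 (outside x∈T) x∈A
    union-clique : Clique 𝔭 (A ∪ T)
    union-clique {x} {y} x∈ y∈ with x∈p∪q⁻ A T x∈ | x∈p∪q⁻ A T y∈
    ... | inj₁ x∈A | inj₁ y∈A = member⇒clique A∈𝔭 x∈A y∈A
    ... | inj₁ x∈A | inj₂ y∈T = ∉N⇒paired 𝔭 (outside y∈T) x∈A
    ... | inj₂ x∈T | inj₁ y∈A = subst (λ P → 𝔭 P ≡ true) (∪-comm ⁅ y ⁆ ⁅ x ⁆) (∉N⇒paired 𝔭 (outside x∈T) y∈A)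
    ... | inj₂ x∈T | inj₂ y∈T = T-clique x∈T y∈T

  maximum⇒N-full : ∀ {A} → 𝔭 A ≡ true → ∣ A ∣ ≡ α 𝔭 → ∣ N[ 𝔭 ] A ∣ ≡ n
  maximum⇒N-full {A} A∈𝔭 A-max = trans (cong (_+ ∣ N ∣) (sym ∁N-empty)) (size-∁ N)
    where
    N : Subset n
    N = N[ 𝔭 ] A
    -- a point b outside N[A] would extend A to a member of size α + 1
    nothing-outside : Empty (∁ N)
    nothing-outside (b , b∈∁N) = <-irrefl A-max (begin-strict
      ∣ A ∣             <⟨ m<m+n ∣ A ∣ z<s ⟩
      ∣ A ∣ + 1         ≡⟨ cong (∣ A ∣ +_) (∣⁅x⁆∣≡1 b) ⟨
      ∣ A ∣ + ∣ ⁅ b ⁆ ∣ ≤⟨ extension A∈𝔭 outside singleton-clique ⟩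
      α 𝔭               ∎)
      where
      open ≤-Reasoning
      outside : ∀ {t} → t ∈ ⁅ b ⁆ → t ∉ N
      outside t∈ rewrite x∈⁅y⁆⇒x≡y b t∈ = x∈∁p⇒x∉p b∈∁N
      singleton-clique : Clique 𝔭 ⁅ b ⁆
      singleton-clique x∈ y∈ rewrite x∈⁅y⁆⇒x≡y b x∈ | x∈⁅y⁆⇒x≡y b y∈ | ∪-idem ⁅ b ⁆ = singletons b
    ∁N-empty : ∣ ∁ N ∣ ≡ 0
    ∁N-empty = trans (cong ∣_∣ (Empty-unique nothing-outside)) (∣⊥∣≡0 n)

  ratio-equality : ∀ {A} → 𝔭 A ≡ true →
                   (∣ A ∣ * n ≡ α 𝔭 * ∣ N[ 𝔭 ] A ∣) ⇔ (A ≡ ⊥ ⊎ ∣ A ∣ ≡ α 𝔭 ⊎ Imprimitive 𝔭 A)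
  ratio-equality {A} A∈𝔭 = mk⇔ classify equality
    where
    classify : ∣ A ∣ * n ≡ α 𝔭 * ∣ N[ 𝔭 ] A ∣ → A ≡ ⊥ ⊎ ∣ A ∣ ≡ α 𝔭 ⊎ Imprimitive 𝔭 A
    classify ratio with ∣ A ∣ in size | m≤n⇒m<n∨m≡n (α-bound 𝔭 A∈𝔭)
    ... | zero  | _          = inj₁ (size≡0⇒≡⊥ size)
    ... | suc k | inj₂ A-max = inj₂ (inj₁ A-max)
    ... | suc k | inj₁ A<α   = inj₂ (inj₂ (size>0⇒nonempty (subst (0 <_) (sym size) z<s) , A∈𝔭 , A<α , ratio))
    equality : A ≡ ⊥ ⊎ ∣ A ∣ ≡ α 𝔭 ⊎ Imprimitive 𝔭 A → ∣ A ∣ * n ≡ α 𝔭 * ∣ N[ 𝔭 ] A ∣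
    equality (inj₁ refl) rewrite ∣⊥∣≡0 n | N[⊥]≡⊥ 𝔭 | ∣⊥∣≡0 n = sym (*-zeroʳ (α 𝔭))
    equality (inj₂ (inj₁ A-max)) rewrite maximum⇒N-full A∈𝔭 A-max = cong (_* n) A-max
    equality (inj₂ (inj₂ (_ , _ , _ , ratio))) = ratio

sum-bijection : ∀ {n} (τ τ⁻ : Fin n → Fin n) → (∀ y → τ (τ⁻ y) ≡ y) → (∀ x → τ⁻ (τ x) ≡ x) →
                (g : Fin n → ℕ) → sum (g ∘ τ) ≡ sum g
sum-bijection τ τ⁻ right left g = sym (sum-permute g (permutation τ τ⁻ right left))

-- Sum of F over all maps Fin k → Fin n, the maps being represented by vectors; the
-- lemmas below lift congruence, monotonicity, linearity and reindexing from `sum`.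
∑ᵛ : ∀ {n} k → (Vec (Fin n) k → ℕ) → ℕ
∑ᵛ zero    F = F []
∑ᵛ (suc k) F = sum (λ i → ∑ᵛ k (λ v → F (i ∷ v)))

∑ᵛ-cong : ∀ {n} k {F G : Vec (Fin n) k → ℕ} → (∀ v → F v ≡ G v) → ∑ᵛ k F ≡ ∑ᵛ k G
∑ᵛ-cong zero    F≡G = F≡G []
∑ᵛ-cong (suc k) F≡G = sum-cong-≗ (λ i → ∑ᵛ-cong k (λ v → F≡G (i ∷ v)))

∑ᵛ-mono : ∀ {n} k {F G : Vec (Fin n) k → ℕ} → (∀ v → F v ≤ G v) → ∑ᵛ k F ≤ ∑ᵛ k G
∑ᵛ-mono zero    F≤G = F≤G []
∑ᵛ-mono (suc k) F≤G = sum-mono (λ i → ∑ᵛ-mono k (λ v → F≤G (i ∷ v)))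

∑ᵛ-*ˡ : ∀ {n} k c (F : Vec (Fin n) k → ℕ) → ∑ᵛ k (λ v → c * F v) ≡ c * ∑ᵛ k F
∑ᵛ-*ˡ zero    c F = refl
∑ᵛ-*ˡ (suc k) c F = trans (sum-cong-≗ (λ i → ∑ᵛ-*ˡ k c (λ v → F (i ∷ v))))
                          (sum-*ˡ c (λ i → ∑ᵛ k (λ v → F (i ∷ v))))

∑ᵛ-sum : ∀ {n m} k (F : Vec (Fin n) k → Fin m → ℕ) →
         ∑ᵛ k (λ v → sum (F v)) ≡ sum (λ x → ∑ᵛ k (λ v → F v x))
∑ᵛ-sum zero    F = refl
∑ᵛ-sum (suc k) F = trans (sum-cong-≗ (λ i → ∑ᵛ-sum k (λ v → F (i ∷ v))))
                         (∑-comm (λ i x → ∑ᵛ k (λ v → F (i ∷ v) x)))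

term≤∑ᵛ : ∀ {n} k (F : Vec (Fin n) k → ℕ) v → F v ≤ ∑ᵛ k F
term≤∑ᵛ zero    F []      = ≤-refl
term≤∑ᵛ (suc k) F (i ∷ v) = ≤-trans (term≤∑ᵛ k (λ u → F (i ∷ u)) v)
                                    (term≤sum (λ j → ∑ᵛ k (λ u → F (j ∷ u))) i)

∑ᵛ-bijection : ∀ {n} k (τ τ⁻ : Fin n → Fin n) → (∀ y → τ (τ⁻ y) ≡ y) → (∀ x → τ⁻ (τ x) ≡ x) →
               (F : Vec (Fin n) k → ℕ) → ∑ᵛ k (F ∘ map τ) ≡ ∑ᵛ k F
∑ᵛ-bijection zero    τ τ⁻ right left F = refl
∑ᵛ-bijection (suc k) τ τ⁻ right left F =
  trans (sum-cong-≗ (λ i → ∑ᵛ-bijection k τ τ⁻ right left (λ v → F (τ i ∷ v))))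
        (sum-bijection τ τ⁻ right left (λ j → ∑ᵛ k (λ v → F (j ∷ v))))

-- An automorphism of the pair structure of 𝔭: an injective self-map of X sending
-- 𝔭-pairs to 𝔭-pairs.  These are finitely many, so one can average over them.
IsAutomorphism : ∀ {n} → Family n → (Fin n → Fin n) → Set
IsAutomorphism 𝔭 σ = (∀ x y → σ x ≡ σ y → x ≡ y)
                   × (∀ x y → 𝔭 (pair x y) ≡ true → 𝔭 (pair (σ x) (σ y)) ≡ true)

automorphism? : ∀ {n} (𝔭 : Family n) σ → Dec (IsAutomorphism 𝔭 σ)
automorphism? 𝔭 σ =
  (all? λ x → all? λ y → (σ x ≟ σ y) →-dec (x ≟ y)) ×-dec
  (all? λ x → all? λ y → (𝔭 (pair x y) ≟ᴮ true) →-dec (𝔭 (pair (σ x) (σ y)) ≟ᴮ true))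

automorphism-id : ∀ {n} (𝔭 : Family n) → IsAutomorphism 𝔭 id
automorphism-id 𝔭 = (λ x y eq → eq) , (λ x y xy∈𝔭 → xy∈𝔭)

automorphism-∘ : ∀ {n} {𝔭 : Family n} {τ σ} →
                 IsAutomorphism 𝔭 τ → IsAutomorphism 𝔭 σ → IsAutomorphism 𝔭 (τ ∘ σ)
automorphism-∘ {τ = τ} {σ} (τ-inj , τ-pairs) (σ-inj , σ-pairs) =
  (λ x y eq → σ-inj x y (τ-inj (σ x) (σ y) eq)) , (λ x y xy∈𝔭 → τ-pairs (σ x) (σ y) (σ-pairs x y xy∈𝔭))

automorphism-resp : ∀ {n} {𝔭 : Family n} {σ σ′} → (∀ x → σ x ≡ σ′ x) →
                    IsAutomorphism 𝔭 σ → IsAutomorphism 𝔭 σ′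
automorphism-resp {𝔭 = 𝔭} σ≗σ′ (σ-inj , σ-pairs) =
  (λ x y eq → σ-inj x y (trans (σ≗σ′ x) (trans eq (sym (σ≗σ′ y))))) ,
  (λ x y xy∈𝔭 → subst₂ (λ u v → 𝔭 (pair u v) ≡ true) (σ≗σ′ x) (σ≗σ′ y) (σ-pairs x y xy∈𝔭))

hits : ∀ {n} → Subset n → Subset n → (Fin n → Fin n) → ℕ
hits I B σ = sum (λ x → ⟦ lookup I x ⟧ * ⟦ lookup B (σ x) ⟧)

⟦⟧-split : ∀ a b → ⟦ a ∧ not b ⟧ + ⟦ a ⟧ * ⟦ b ⟧ ≡ ⟦ a ⟧
⟦⟧-split true  true  = refl
⟦⟧-split true  false = refl
⟦⟧-split false b     = refl

-- Automorphism bound: if A, I ∈ 𝔭 and σ is an automorphism, the points of I that σ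
-- sends outside N[A] have images forming a clique outside N[A]; by the extension
-- lemma, σ must send at least |A| + |I| − α points of I into N[A].
automorphism-bound : ∀ {n} {𝔭 : Family n} → IsIndependenceFamily 𝔭 →
                     ∀ {A I σ} → 𝔭 A ≡ true → 𝔭 I ≡ true → IsAutomorphism 𝔭 σ →
                     ∣ A ∣ + ∣ I ∣ ≤ α 𝔭 + hits I (N[ 𝔭 ] A) σ
automorphism-bound {n} {𝔭} ind {A} {I} {σ} A∈𝔭 I∈𝔭 (σ-inj , σ-pairs) = begin
  ∣ A ∣ + ∣ I ∣               ≡⟨ cong (∣ A ∣ +_) split ⟨
  ∣ A ∣ + (∣ S ∣ + h)         ≡⟨ +-assoc ∣ A ∣ ∣ S ∣ h ⟨
  ∣ A ∣ + ∣ S ∣ + h           ≡⟨ cong (λ k → ∣ A ∣ + k + h) (size-image σ (σ-inj _ _) S) ⟨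
  ∣ A ∣ + ∣ image σ S ∣ + h   ≤⟨ +-monoˡ-≤ h (extension A∈𝔭 outside clique) ⟩
  α 𝔭 + h                     ∎
  where
  open IndependenceFamily ind using (extension; member⇒clique)
  open ≤-Reasoning
  N : Subset n
  N = N[ 𝔭 ] A
  h : ℕ
  h = hits I N σ
  S : Subset n
  S = tabulate (λ x → lookup I x ∧ not (lookup N (σ x)))
  split : ∣ S ∣ + h ≡ ∣ I ∣
  split = begin-equality
    ∣ S ∣ + h                                                          ≡⟨ cong (_+ h) (size≡sum S) ⟩
    sum (λ x → ⟦ lookup S x ⟧) + h                                     ≡⟨ ∑-distrib-+ (λ x → ⟦ lookup S x ⟧) _ ⟨
    sum (λ x → ⟦ lookup S x ⟧ + ⟦ lookup I x ⟧ * ⟦ lookup N (σ x) ⟧)   ≡⟨ sum-cong-≗ S+hits≡I ⟩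
    sum (λ x → ⟦ lookup I x ⟧)                                         ≡⟨ size≡sum I ⟨
    ∣ I ∣                                                              ∎
    where
    S+hits≡I : ∀ x → ⟦ lookup S x ⟧ + ⟦ lookup I x ⟧ * ⟦ lookup N (σ x) ⟧ ≡ ⟦ lookup I x ⟧
    S+hits≡I x = trans (cong (λ b → ⟦ b ⟧ + ⟦ lookup I x ⟧ * ⟦ lookup N (σ x) ⟧) (lookup∘tabulate _ x))
                       (⟦⟧-split (lookup I x) _)
  ∈S⁻ : ∀ {x} → x ∈ S → lookup I x ∧ not (lookup N (σ x)) ≡ true
  ∈S⁻ = ∈-tabulate {f = λ x → lookup I x ∧ not (lookup N (σ x))}
  outside : ∀ {t} → t ∈ image σ S → t ∉ N
  outside t∈ with ∈-image⁻ {τ = σ} {S = S} t∈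
  ... | x , x∈S , refl = lookup⇒∉ (not-injective (∧-conicalʳ _ _ (∈S⁻ x∈S)))
  clique : Clique 𝔭 (image σ S)
  clique t∈ t′∈ with ∈-image⁻ {τ = σ} {S = S} t∈ | ∈-image⁻ {τ = σ} {S = S} t′∈
  ... | x , x∈S , refl | x′ , x′∈S , refl =
    σ-pairs x x′ (member⇒clique I∈𝔭 (in-I x∈S) (in-I x′∈S))
    where
    in-I : ∀ {x} → x ∈ S → x ∈ I
    in-I x∈S = lookup⇒∈ (∧-conicalˡ _ _ (∈S⁻ x∈S))

module Symmetry {c ℓ n} {𝔭 : Family n} (symmetric : IsSymmetric c ℓ 𝔭) where
  open IsSymmetric symmetric
  open Group Γ using (_⁻¹; inverseˡ; inverseʳ)

  act-inverseˡ : ∀ δ x → act (δ ⁻¹) (act δ x) ≡ x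
  act-inverseˡ δ x = trans (sym (act-∙ (δ ⁻¹) δ x)) (trans (act-cong (inverseˡ δ) x) (act-ε x))

  act-inverseʳ : ∀ δ x → act δ (act (δ ⁻¹) x) ≡ x
  act-inverseʳ δ x = trans (sym (act-∙ δ (δ ⁻¹) x)) (trans (act-cong (inverseʳ δ) x) (act-ε x))

  act-injective : ∀ δ {a b} → act δ a ≡ act δ b → a ≡ b
  act-injective δ {a} {b} eq = trans (sym (act-inverseˡ δ a)) (trans (cong (act (δ ⁻¹)) eq) (act-inverseˡ δ b))

  act-pair : ∀ δ {a b} → 𝔭 (pair a b) ≡ true → 𝔭 (pair (act δ a) (act δ b)) ≡ true
  act-pair δ {a} {b} ab∈𝔭 = subst (λ P → 𝔭 P ≡ true) (image-pair (act δ) a b) (preserves δ (pair a b) ab∈𝔭)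

  act-automorphism : ∀ δ → IsAutomorphism 𝔭 (act δ)
  act-automorphism δ = (λ x y → act-injective δ) , (λ x y → act-pair δ)

  automorphism-translate : ∀ δ σ → IsAutomorphism 𝔭 σ ⇔ IsAutomorphism 𝔭 (act δ ∘ σ)
  automorphism-translate δ σ = mk⇔ (automorphism-∘ {𝔭 = 𝔭} (act-automorphism δ)) untranslate
    where
    untranslate : IsAutomorphism 𝔭 (act δ ∘ σ) → IsAutomorphism 𝔭 σ
    untranslate aut = automorphism-resp {𝔭 = 𝔭} (act-inverseˡ δ ∘ σ)
                                        (automorphism-∘ {𝔭 = 𝔭} (act-automorphism (δ ⁻¹)) aut)

-- By transitivity of Γ, every y is the image of a
-- given x under equally many automorphisms, which turns the automorphism bound into
-- the ratio bound |A| · |X| ≤ α · |N[A]|.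
module Averaging {c ℓ n} {𝔭 : Family n} (symmetric : IsSymmetric c ℓ 𝔭) where
  open IsSymmetric symmetric using (Γ; act; transitive)
  open Group Γ using (_⁻¹)
  open Symmetry symmetric

  weight : Vec (Fin n) n → ℕ
  weight v = ⟦ does (automorphism? 𝔭 (lookup v)) ⟧

  #Aut : ℕ
  #Aut = ∑ᵛ n weight

  #Aut[_↦_] : Fin n → Fin n → ℕ
  #Aut[ x ↦ y ] = ∑ᵛ n (λ v → weight v * ⟦ lookup v x == y ⟧)

  weighted-≤ : ∀ {f g : Vec (Fin n) n → ℕ} → (∀ v → IsAutomorphism 𝔭 (lookup v) → f v ≤ g v) →
               ∀ v → weight v * f v ≤ weight v * g v
  weighted-≤ f≤g v = indicator-*-mono (automorphism? 𝔭 (lookup v)) (f≤g v)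

  -- the identity is an automorphism
  #Aut-positive : 0 < #Aut
  #Aut-positive = ≤-trans (≤-reflexive (cong ⟦_⟧ (sym (dec-true (automorphism? 𝔭 (lookup ι)) ι-aut))))
                          (term≤∑ᵛ n weight ι)
    where
    ι : Vec (Fin n) n
    ι = tabulate id
    ι-aut : IsAutomorphism 𝔭 (lookup ι)
    ι-aut = automorphism-resp {𝔭 = 𝔭} (λ x → sym (lookup∘tabulate id x)) (automorphism-id 𝔭)

  weight-translate : ∀ δ v → weight (map (act δ) v) ≡ weight v
  weight-translate δ v = cong ⟦_⟧ (does-⇔ equivalent (automorphism? 𝔭 _) (automorphism? 𝔭 _))
    where
    lookup-translate : ∀ x → act δ (lookup v x) ≡ lookup (map (act δ) v) x
    lookup-translate x = sym (lookup-map x (act δ) v)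
    open Equivalence (automorphism-translate δ (lookup v))
    equivalent : IsAutomorphism 𝔭 (lookup (map (act δ) v)) ⇔ IsAutomorphism 𝔭 (lookup v)
    equivalent = mk⇔ (λ aut → from (automorphism-resp {𝔭 = 𝔭} (sym ∘ lookup-translate) aut))
                     (λ aut → automorphism-resp {𝔭 = 𝔭} lookup-translate (to aut))

  -- Transitivity: #Aut[ x ↦ y ] does not depend on y.
  #Aut↦-uniform : ∀ x y y′ → #Aut[ x ↦ y ] ≡ #Aut[ x ↦ y′ ]
  #Aut↦-uniform x y y′ with transitive y y′
  ... | δ , refl = begin
    ∑ᵛ n (λ v → weight v * ⟦ lookup v x == y ⟧)  ≡⟨ ∑ᵛ-cong n translated ⟨
    ∑ᵛ n (F ∘ map (act δ))                       ≡⟨ ∑ᵛ-bijection n (act δ) (act (δ ⁻¹)) (act-inverseʳ δ) (act-inverseˡ δ) F ⟩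
    ∑ᵛ n F                                       ∎
    where
    open ≡-Reasoning
    F : Vec (Fin n) n → ℕ
    F v = weight v * ⟦ lookup v x == act δ y ⟧
    translated : ∀ v → F (map (act δ) v) ≡ weight v * ⟦ lookup v x == y ⟧
    translated v = cong₂ _*_ (weight-translate δ v)
      (cong ⟦_⟧ (trans (cong (_== act δ y) (lookup-map x (act δ) v))
                       (==-injective (act δ) (act-injective δ) (lookup v x) y)))

  #Aut≡n*#Aut↦ : ∀ x y → #Aut ≡ n * #Aut[ x ↦ y ]
  #Aut≡n*#Aut↦ x y = begin
    ∑ᵛ n weight                                            ≡⟨ ∑ᵛ-cong n spread ⟩
    ∑ᵛ n (λ v → sum (λ y′ → weight v * ⟦ lookup v x == y′ ⟧)) ≡⟨ ∑ᵛ-sum n (λ v y′ → weight v * ⟦ lookup v x == y′ ⟧) ⟩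
    sum (λ y′ → #Aut[ x ↦ y′ ])                             ≡⟨ sum-cong-≗ (λ y′ → #Aut↦-uniform x y′ y) ⟩
    sum {n} (λ _ → #Aut[ x ↦ y ])                           ≡⟨ sum-const n _ ⟩
    n * #Aut[ x ↦ y ]                                       ∎
    where
    open ≡-Reasoning
    spread : ∀ v → weight v ≡ sum (λ y′ → weight v * ⟦ lookup v x == y′ ⟧)
    spread v = begin
      weight v                                       ≡⟨ *-identityʳ (weight v) ⟨
      weight v * 1                                   ≡⟨ cong (weight v *_) (sum-δ₁ (lookup v x)) ⟨
      weight v * sum (λ y′ → ⟦ lookup v x == y′ ⟧)   ≡⟨ sum-*ˡ (weight v) (λ y′ → ⟦ lookup v x == y′ ⟧) ⟨
      sum (λ y′ → weight v * ⟦ lookup v x == y′ ⟧)   ∎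

  -- Double counting the pairs (automorphism σ, point x ∈ I with σ x ∈ B).
  total-hits : ∀ I B → n * ∑ᵛ n (λ v → weight v * hits I B (lookup v)) ≡ #Aut * (∣ I ∣ * ∣ B ∣)
  total-hits I B = begin
    n * ∑ᵛ n (λ v → weight v * hits I B (lookup v))
      ≡⟨ cong (n *_) (∑ᵛ-cong n expand) ⟩
    n * ∑ᵛ n (λ v → sum (λ x → sum (λ y → K x y * (weight v * ⟦ lookup v x == y ⟧))))
      ≡⟨ cong (n *_) collect ⟩
    n * sum (λ x → sum (λ y → K x y * #Aut[ x ↦ y ]))
      ≡⟨ sum-*ˡ n (λ x → sum (λ y → K x y * #Aut[ x ↦ y ])) ⟨
    sum (λ x → n * sum (λ y → K x y * #Aut[ x ↦ y ]))
      ≡⟨ sum-cong-≗ (λ x → trans (sym (sum-*ˡ n (λ y → K x y * #Aut[ x ↦ y ]))) (sum-cong-≗ (uniform x))) ⟩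
    sum (λ x → sum (λ y → #Aut * K x y))
      ≡⟨ sum-cong-≗ (λ x → sum-*ˡ #Aut (K x)) ⟩
    sum (λ x → #Aut * sum (λ y → K x y))
      ≡⟨ sum-*ˡ #Aut (λ x → sum (K x)) ⟩
    #Aut * sum (λ x → sum (λ y → K x y))
      ≡⟨ cong (#Aut *_) (size-product I B) ⟩
    #Aut * (∣ I ∣ * ∣ B ∣)
      ∎
    where
    open ≡-Reasoning
    K : Fin n → Fin n → ℕ
    K x y = ⟦ lookup I x ⟧ * ⟦ lookup B y ⟧
    rearrange : ∀ w a e b → w * (a * (e * b)) ≡ (a * b) * (w * e)
    rearrange = solve 4 (λ w a e b → w :* (a :* (e :* b)) := (a :* b) :* (w :* e)) refl
    -- ⟦ σ x ∈ B ⟧ written as a sum over the possible values y of σ x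
    expand-at : ∀ v x → weight v * (⟦ lookup I x ⟧ * ⟦ lookup B (lookup v x) ⟧)
                      ≡ sum (λ y → K x y * (weight v * ⟦ lookup v x == y ⟧))
    expand-at v x = begin
      weight v * (⟦ lookup I x ⟧ * ⟦ lookup B (lookup v x) ⟧)
        ≡⟨ cong (λ k → weight v * (⟦ lookup I x ⟧ * k)) (sum-δ (lookup v x) (λ y → ⟦ lookup B y ⟧)) ⟨
      weight v * (⟦ lookup I x ⟧ * sum (λ y → ⟦ lookup v x == y ⟧ * ⟦ lookup B y ⟧))
        ≡⟨ cong (weight v *_) (sum-*ˡ ⟦ lookup I x ⟧ (λ y → ⟦ lookup v x == y ⟧ * ⟦ lookup B y ⟧)) ⟨
      weight v * sum (λ y → ⟦ lookup I x ⟧ * (⟦ lookup v x == y ⟧ * ⟦ lookup B y ⟧))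
        ≡⟨ sum-*ˡ (weight v) (λ y → ⟦ lookup I x ⟧ * (⟦ lookup v x == y ⟧ * ⟦ lookup B y ⟧)) ⟨
      sum (λ y → weight v * (⟦ lookup I x ⟧ * (⟦ lookup v x == y ⟧ * ⟦ lookup B y ⟧)))
        ≡⟨ sum-cong-≗ (λ y → rearrange (weight v) ⟦ lookup I x ⟧ ⟦ lookup v x == y ⟧ ⟦ lookup B y ⟧) ⟩
      sum (λ y → K x y * (weight v * ⟦ lookup v x == y ⟧))
        ∎
    expand : ∀ v → weight v * hits I B (lookup v) ≡ sum (λ x → sum (λ y → K x y * (weight v * ⟦ lookup v x == y ⟧)))
    expand v = trans (sym (sum-*ˡ (weight v) (λ x → ⟦ lookup I x ⟧ * ⟦ lookup B (lookup v x) ⟧)))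
                     (sum-cong-≗ (expand-at v))
    collect : ∑ᵛ n (λ v → sum (λ x → sum (λ y → K x y * (weight v * ⟦ lookup v x == y ⟧))))
            ≡ sum (λ x → sum (λ y → K x y * #Aut[ x ↦ y ]))
    collect = trans (∑ᵛ-sum n (λ v x → sum (λ y → K x y * (weight v * ⟦ lookup v x == y ⟧))))
                    (sum-cong-≗ λ x → trans (∑ᵛ-sum n (λ v y → K x y * (weight v * ⟦ lookup v x == y ⟧)))
                                            (sum-cong-≗ λ y → ∑ᵛ-*ˡ n (K x y) (λ v → weight v * ⟦ lookup v x == y ⟧)))
    uniform : ∀ x y → n * (K x y * #Aut[ x ↦ y ]) ≡ #Aut * K x y
    uniform x y = begin
      n * (K x y * #Aut[ x ↦ y ])  ≡⟨ x∙yz≈y∙xz n (K x y) _ ⟩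
      K x y * (n * #Aut[ x ↦ y ])  ≡⟨ cong (K x y *_) (#Aut≡n*#Aut↦ x y) ⟨
      K x y * #Aut                 ≡⟨ *-comm (K x y) #Aut ⟩
      #Aut * K x y                 ∎

  neighbourhood-bound : IsIndependenceFamily 𝔭 → ∀ {A} → 𝔭 A ≡ true → ∣ A ∣ * n ≤ α 𝔭 * ∣ N[ 𝔭 ] A ∣
  neighbourhood-bound ind {A} A∈𝔭 with α-attained 𝔭
  ... | inj₁ α≡0 = subst (λ k → k * n ≤ α 𝔭 * ∣ N[ 𝔭 ] A ∣) (sym A-empty) z≤n
    where
    A-empty : ∣ A ∣ ≡ 0
    A-empty = n≤0⇒n≡0 (subst (∣ A ∣ ≤_) α≡0 (α-bound 𝔭 A∈𝔭))
  ... | inj₂ (I , I∈𝔭 , I-max) = *-cancelˡ-≤ #Aut {{>-nonZero #Aut-positive}} (begin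
    #Aut * (∣ A ∣ * n)                                 ≡⟨ x∙yz≈z∙xy #Aut ∣ A ∣ n ⟩
    n * (#Aut * ∣ A ∣)                                 ≡⟨ cong (n *_) weighted-A ⟨
    n * ∑ᵛ n (λ v → weight v * ∣ A ∣)                  ≤⟨ *-monoʳ-≤ n (∑ᵛ-mono n (weighted-≤ A≤hits)) ⟩
    n * ∑ᵛ n (λ v → weight v * hits I N (lookup v))    ≡⟨ total-hits I N ⟩
    #Aut * (∣ I ∣ * ∣ N ∣)                             ≡⟨ cong (λ k → #Aut * (k * ∣ N ∣)) I-max ⟩
    #Aut * (α 𝔭 * ∣ N ∣)                               ∎)
    where
    open ≤-Reasoning
    N : Subset n
    N = N[ 𝔭 ] A
    weighted-A : ∑ᵛ n (λ v → weight v * ∣ A ∣) ≡ #Aut * ∣ A ∣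
    weighted-A = trans (∑ᵛ-cong n (λ v → *-comm (weight v) ∣ A ∣))
                       (trans (∑ᵛ-*ˡ n ∣ A ∣ weight) (*-comm ∣ A ∣ #Aut))
    -- the automorphism bound, with |I| = α cancelled
    A≤hits : ∀ v → IsAutomorphism 𝔭 (lookup v) → ∣ A ∣ ≤ hits I N (lookup v)
    A≤hits v aut = +-cancelʳ-≤ (α 𝔭) ∣ A ∣ h
      (subst₂ _≤_ (cong (∣ A ∣ +_) I-max) (+-comm (α 𝔭) h) (automorphism-bound ind A∈𝔭 I∈𝔭 aut))
      where
      h : ℕ
      h = hits I N (lookup v)

corollary2p4 : {c ℓ : Level} (n : ℕ) (𝔭 : Family n) → IsIndependenceFamily 𝔭 → IsSymmetric c ℓ 𝔭 →
    (A : Subset n) → 𝔭 A ≡ true →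
    (∣ A ∣ * n + α 𝔭 * ∣ N̄[ 𝔭 ] A ∣ ≤ α 𝔭 * n)
    × ((∣ A ∣ * n + α 𝔭 * ∣ N̄[ 𝔭 ] A ∣ ≡ α 𝔭 * n)
    ⇔ (A ≡ ⊥ ⊎ ∣ A ∣ ≡ α 𝔭 ⊎ Imprimitive 𝔭 A))
corollary2p4 n 𝔭 ind symmetric A A∈𝔭 =
  subst (∣ A ∣ * n + α∣N̄∣ ≤_) (sym partition) (+-monoˡ-≤ α∣N̄∣ (neighbourhood-bound ind A∈𝔭)) ,
  mk⇔ (to (ratio-equality A∈𝔭) ∘ unshift) (shift ∘ from (ratio-equality A∈𝔭))
  where
  open Averaging symmetric using (neighbourhood-bound)
  open IndependenceFamily ind using (ratio-equality)
  open Equivalence using (to; from)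
  N : Subset n
  N = N[ 𝔭 ] A
  α∣N̄∣ : ℕ
  α∣N̄∣ = α 𝔭 * ∣ N̄[ 𝔭 ] A ∣
  -- α · |X| = α · |N[A]| + α · |N̄[A]|, so the claim is the ratio bound shifted by α · |N̄[A]|
  partition : α 𝔭 * n ≡ α 𝔭 * ∣ N ∣ + α∣N̄∣
  partition = trans (cong (α 𝔭 *_) (trans (sym (size-∁ N)) (+-comm ∣ ∁ N ∣ ∣ N ∣))) (*-distribˡ-+ (α 𝔭) ∣ N ∣ ∣ ∁ N ∣)
  shift : ∣ A ∣ * n ≡ α 𝔭 * ∣ N ∣ → ∣ A ∣ * n + α∣N̄∣ ≡ α 𝔭 * n
  shift ratio = trans (cong (_+ α∣N̄∣) ratio) (sym partition)
  unshift : ∣ A ∣ * n + α∣N̄∣ ≡ α 𝔭 * n → ∣ A ∣ * n ≡ α 𝔭 * ∣ N ∣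
  unshift eq = +-cancelʳ-≡ α∣N̄∣ (∣ A ∣ * n) (α 𝔭 * ∣ N ∣) (trans eq partition)
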